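{- Let $H$ be an intersecting hypergraph with $e$ edges and maximum degree $\Delta$. Then $\tau(H)\le 1+\lceil (e-\Delta)/2\rceil$. Consequently, if $H$ is $r$-uniform and $\tau(H)=r-1$, then $\Delta\le e+4-2r$ if $e-\Delta$ is even, and $\Delta\le e+5-2r$ if $e-\Delta$ is odd.
   Context: A hypergraph is intersecting if any two edges share at least one vertex, and $r$-uniform if every edge has exactly $r$ vertices. The covering number $\tau(H)$ is the minimum size of a set of vertices meeting every edge. The degree of a vertex is the number of edges containing it. Hypergraphs are finite and simple, with at least one edge. -}

module Defs where

open import Data.Nat using (ℕ; _≤_)
open import Data.Fin using (Fin)
open import Data.Fin.Subset using (Subset; _∈_; _∩_; ∣_∣; Nonempty)
open import Data.Fin.Subset.Properties using (_∈?_)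
open import Data.List using (List; length; filter; [])
open import Data.List.Membership.Propositional renaming (_∈_ to _∈ₗ_)
open import Data.List.Relation.Unary.Unique.Propositional using (Unique)
open import Data.Product using (Σ; ∃; _×_)
open import Relation.Binary.PropositionalEquality using (_≡_; _≢_)

record Hypergraph (n : ℕ) : Set where
  field
    edges    : List (Subset n)
    simple   : Unique edges
    nonEmpty : edges ≢ []
    edgeNonempty : ∀ {E} → E ∈ₗ edges → Nonempty E
open Hypergraph public

numEdges : ∀ {n} → Hypergraph n → ℕ
numEdges H = length (edges H)

Intersecting : ∀ {n} → Hypergraph n → Set
Intersecting H = ∀ {E F} → E ∈ₗ edges H → F ∈ₗ edges H → Nonempty (E ∩ F)

Uniform : ∀ {n} → ℕ → Hypergraph n → Set
Uniform r H = ∀ {E} → E ∈ₗ edges H → ∣ E ∣ ≡ r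

degree : ∀ {n} → Hypergraph n → Fin n → ℕ
degree H v = length (filter (v ∈?_) (edges H))

IsMaxDegree : ∀ {n} → Hypergraph n → ℕ → Set
IsMaxDegree {n} H d = (∃ λ (v : Fin n) → degree H v ≡ d) × (∀ v → degree H v ≤ d)

IsCover : ∀ {n} → Hypergraph n → Subset n → Set
IsCover H C = ∀ {E} → E ∈ₗ edges H → Nonempty (C ∩ E)

IsCoveringNumber : ∀ {n} → Hypergraph n → ℕ → Set
IsCoveringNumber {n} H t =
  (Σ (Subset n) λ C → IsCover H C × ∣ C ∣ ≡ t) × (∀ C → IsCover H C → t ≤ ∣ C ∣)

{-# OPTIONS --safe #-}
module Submission where

-- Pick a vertex v of maximum degree Δ.  The Δ edges through v are met by v;
-- the other e − Δ edges still pairwise intersect, so grouping them into pairs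
-- and choosing a common vertex of each pair (plus any vertex of a leftover
-- edge) meets them with ⌈(e − Δ)/2⌉ vertices.  The uniform consequence is then
-- pure arithmetic on r = τ + 1 ≤ 2 + ⌈(e − Δ)/2⌉.

open import Defs
open import Data.Nat using (ℕ; zero; suc; _≤_; _+_; _*_; _∸_; _%_; ⌈_/2⌉; z≤n; s≤s)
open import Data.Nat.Properties
open import Data.Product using (∃; _×_; _,_; proj₁; proj₂)
open import Data.Sum using (inj₁; inj₂)
open import Data.Vec using ([]; _∷_)
open import Data.Fin using (Fin)
open import Data.Fin.Subset using (Subset; _∈_; _∩_; _∪_; ∣_∣; Nonempty; ⁅_⁆; ⊥; inside; outside)
open import Data.Fin.Subset.Properties
  using (_∈?_; x∈p∩q⁺; x∈p∩q⁻; x∈p∪q⁺; ∣⁅x⁆∣≡1; ∣⊥∣≡0; x∈⁅x⁆)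
open import Data.List using (List; length; filter; []; _∷_)
open import Data.List.Properties using (length-filter)
open import Data.List.Membership.Propositional renaming (_∈_ to _∈ₗ_)
open import Data.List.Membership.Propositional.Properties using (∈-filter⁺; ∈-filter⁻)
open import Data.List.Relation.Unary.Any using (here; there)
open import Data.Nat.Tactic.RingSolver using (solve-∀)
open import Relation.Nullary using (yes; no)
open import Relation.Unary using (Pred; Decidable)
open import Relation.Unary.Properties using (∁?)
open import Relation.Binary.PropositionalEquality
  using (_≡_; refl; trans; cong; subst; module ≡-Reasoning)

∣p∪q∣≤∣p∣+∣q∣ : ∀ {n} (p q : Subset n) → ∣ p ∪ q ∣ ≤ ∣ p ∣ + ∣ q ∣
∣p∪q∣≤∣p∣+∣q∣ []            []            = z≤n
∣p∪q∣≤∣p∣+∣q∣ (outside ∷ p) (outside ∷ q) = ∣p∪q∣≤∣p∣+∣q∣ p q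
∣p∪q∣≤∣p∣+∣q∣ (outside ∷ p) (inside ∷ q)  rewrite +-suc ∣ p ∣ ∣ q ∣ = s≤s (∣p∪q∣≤∣p∣+∣q∣ p q)
∣p∪q∣≤∣p∣+∣q∣ (inside ∷ p)  (outside ∷ q) = s≤s (∣p∪q∣≤∣p∣+∣q∣ p q)
∣p∪q∣≤∣p∣+∣q∣ (inside ∷ p)  (inside ∷ q)  =
  s≤s (≤-trans (∣p∪q∣≤∣p∣+∣q∣ p q) (+-monoʳ-≤ ∣ p ∣ (n≤1+n ∣ q ∣)))

∣⁅x⁆∪p∣≤1+∣p∣ : ∀ {n} (x : Fin n) (p : Subset n) → ∣ ⁅ x ⁆ ∪ p ∣ ≤ 1 + ∣ p ∣
∣⁅x⁆∪p∣≤1+∣p∣ x p =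
  ≤-trans (∣p∪q∣≤∣p∣+∣q∣ ⁅ x ⁆ p) (≤-reflexive (cong (_+ ∣ p ∣) (∣⁅x⁆∣≡1 x)))

module _ {a p} {A : Set a} {P : Pred A p} (P? : Decidable P) where

  length-filter-∁ : ∀ xs → length (filter (∁? P?) xs) ≡ length xs ∸ length (filter P? xs)
  length-filter-∁ xs = begin
    length (filter (∁? P?) xs)
      ≡⟨ m+n∸m≡n (length (filter P? xs)) _ ⟨
    length (filter P? xs) + length (filter (∁? P?) xs) ∸ length (filter P? xs)
      ≡⟨ cong (_∸ length (filter P? xs)) (length-filter+length-filter-∁ xs) ⟩
    length xs ∸ length (filter P? xs)
      ∎
    where
    open ≡-Reasoning
    length-filter+length-filter-∁ : ∀ xs → length (filter P? xs) + length (filter (∁? P?) xs) ≡ length xs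
    length-filter+length-filter-∁ []       = refl
    length-filter+length-filter-∁ (x ∷ xs) with P? x
    ... | yes _ = cong suc (length-filter+length-filter-∁ xs)
    ... | no  _ = trans (+-suc _ _) (cong suc (length-filter+length-filter-∁ xs))

module _ {n : ℕ} where

  Covers : Subset n → List (Subset n) → Set
  Covers C L = ∀ {E} → E ∈ₗ L → Nonempty (C ∩ E)

  PairwiseIntersecting : List (Subset n) → Set
  PairwiseIntersecting L = ∀ {E F} → E ∈ₗ L → F ∈ₗ L → Nonempty (E ∩ F)

  ⁅x⁆-meets : ∀ {x : Fin n} {E : Subset n} → x ∈ E → Nonempty (⁅ x ⁆ ∩ E)
  ⁅x⁆-meets {x} x∈E = x , x∈p∩q⁺ (x∈⁅x⁆ x , x∈E)

  ∪-meetsˡ : ∀ {C D E : Subset n} → Nonempty (C ∩ E) → Nonempty ((C ∪ D) ∩ E)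
  ∪-meetsˡ {C} {E = E} (x , x∈C∩E) with x∈p∩q⁻ C E x∈C∩E
  ... | x∈C , x∈E = x , x∈p∩q⁺ (x∈p∪q⁺ (inj₁ x∈C) , x∈E)

  ∪-meetsʳ : ∀ {C D E : Subset n} → Nonempty (D ∩ E) → Nonempty ((C ∪ D) ∩ E)
  ∪-meetsʳ {D = D} {E} (x , x∈D∩E) with x∈p∩q⁻ D E x∈D∩E
  ... | x∈D , x∈E = x , x∈p∩q⁺ (x∈p∪q⁺ (inj₂ x∈D) , x∈E)

  pairwiseIntersecting-∷⁻ : ∀ {E : Subset n} {L} → PairwiseIntersecting (E ∷ L) → PairwiseIntersecting L
  pairwiseIntersecting-∷⁻ pw E∈ F∈ = pw (there E∈) (there F∈)

  pairwiseIntersecting⇒cover : ∀ L → PairwiseIntersecting L →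
                               ∃ λ C → Covers C L × ∣ C ∣ ≤ ⌈ length L /2⌉
  pairwiseIntersecting⇒cover [] _ = ⊥ , (λ ()) , ≤-reflexive (∣⊥∣≡0 n)
  pairwiseIntersecting⇒cover (E ∷ []) pw with pw (here refl) (here refl)
  ... | x , x∈E∩E = ⁅ x ⁆ , covers , ≤-reflexive (∣⁅x⁆∣≡1 x)
    where
    covers : Covers ⁅ x ⁆ (E ∷ [])
    covers (here refl) = ⁅x⁆-meets (proj₁ (x∈p∩q⁻ E E x∈E∩E))
  pairwiseIntersecting⇒cover (E ∷ F ∷ L) pw
    with pw (here refl) (there (here refl))
       | pairwiseIntersecting⇒cover L (pairwiseIntersecting-∷⁻ (pairwiseIntersecting-∷⁻ pw))
  ... | x , x∈E∩F | C , C-covers , ∣C∣≤ =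
    ⁅ x ⁆ ∪ C , covers , ≤-trans (∣⁅x⁆∪p∣≤1+∣p∣ x C) (s≤s ∣C∣≤)
    where
    covers : Covers (⁅ x ⁆ ∪ C) (E ∷ F ∷ L)
    covers (here refl)         = ∪-meetsˡ (⁅x⁆-meets (proj₁ (x∈p∩q⁻ E F x∈E∩F)))
    covers (there (here refl)) = ∪-meetsˡ (⁅x⁆-meets (proj₂ (x∈p∩q⁻ E F x∈E∩F)))
    covers (there (there G∈L)) = ∪-meetsʳ (C-covers G∈L)

module _ {n : ℕ} (H : Hypergraph n) where

  edgesAvoiding : Fin n → List (Subset n)
  edgesAvoiding v = filter (∁? (v ∈?_)) (edges H)

  length-edgesAvoiding : ∀ v → length (edgesAvoiding v) ≡ numEdges H ∸ degree H v
  length-edgesAvoiding v = length-filter-∁ (v ∈?_) (edges H)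

  degree≤numEdges : ∀ v → degree H v ≤ numEdges H
  degree≤numEdges v = length-filter (v ∈?_) (edges H)

  ⁅v⁆∪cover-isCover : ∀ v {C} → Covers C (edgesAvoiding v) → IsCover H (⁅ v ⁆ ∪ C)
  ⁅v⁆∪cover-isCover v C-covers {E} E∈ with v ∈? E
  ... | yes v∈E = ∪-meetsˡ (⁅x⁆-meets v∈E)
  ... | no  v∉E = ∪-meetsʳ (C-covers (∈-filter⁺ (∁? (v ∈?_)) E∈ v∉E))

  edgesAvoiding-pairwiseIntersecting : Intersecting H → ∀ v → PairwiseIntersecting (edgesAvoiding v)
  edgesAvoiding-pairwiseIntersecting intersecting v E∈ F∈ =
    intersecting (proj₁ (∈-filter⁻ (∁? (v ∈?_)) E∈)) (proj₁ (∈-filter⁻ (∁? (v ∈?_)) F∈))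

  τ≤1+⌈[e∸degree]/2⌉ : Intersecting H → ∀ {t} → IsCoveringNumber H t →
                         ∀ v → t ≤ 1 + ⌈ (numEdges H ∸ degree H v) /2⌉
  τ≤1+⌈[e∸degree]/2⌉ intersecting {t} (_ , minimal) v
    with pairwiseIntersecting⇒cover (edgesAvoiding v) (edgesAvoiding-pairwiseIntersecting intersecting v)
  ... | C , C-covers , ∣C∣≤ = begin
    t                                   ≤⟨ minimal (⁅ v ⁆ ∪ C) (⁅v⁆∪cover-isCover v C-covers) ⟩
    ∣ ⁅ v ⁆ ∪ C ∣                       ≤⟨ ∣⁅x⁆∪p∣≤1+∣p∣ v C ⟩
    1 + ∣ C ∣                           ≤⟨ s≤s ∣C∣≤ ⟩
    1 + ⌈ length (edgesAvoiding v) /2⌉  ≡⟨ cong (λ m → 1 + ⌈ m /2⌉) (length-edgesAvoiding v) ⟩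
    1 + ⌈ (numEdges H ∸ degree H v) /2⌉ ∎
    where open ≤-Reasoning

2*⌈n/2⌉≡n+n%2 : ∀ n → 2 * ⌈ n /2⌉ ≡ n + n % 2
2*⌈n/2⌉≡n+n%2 zero          = refl
2*⌈n/2⌉≡n+n%2 (suc zero)    = refl
2*⌈n/2⌉≡n+n%2 (suc (suc n)) = trans (*-suc 2 ⌈ n /2⌉) (cong (2 +_) (2*⌈n/2⌉≡n+n%2 n))

Δ+2[τ+1]≤e+4+[e∸Δ]%2 : ∀ {Δ e t} → Δ ≤ e → t ≤ 1 + ⌈ (e ∸ Δ) /2⌉ →
                        Δ + 2 * (t + 1) ≤ e + 4 + (e ∸ Δ) % 2
Δ+2[τ+1]≤e+4+[e∸Δ]%2 {Δ} {e} {t} Δ≤e t≤ = begin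
  Δ + 2 * (t + 1)                       ≤⟨ +-monoʳ-≤ Δ (*-monoʳ-≤ 2 (+-monoˡ-≤ 1 t≤)) ⟩
  Δ + 2 * (1 + c + 1)                   ≡⟨ cong (Δ +_) (double c) ⟩
  Δ + (4 + 2 * c)                       ≡⟨ cong (λ k → Δ + (4 + k)) (2*⌈n/2⌉≡n+n%2 m) ⟩
  Δ + (4 + (m + m % 2))                 ≡⟨ rearrange Δ m (m % 2) ⟩
  Δ + m + 4 + m % 2                     ≡⟨ cong (λ k → k + 4 + m % 2) (m+[n∸m]≡n Δ≤e) ⟩
  e + 4 + m % 2                         ∎
  where
  open ≤-Reasoning
  m = e ∸ Δ
  c = ⌈ m /2⌉
  double : ∀ x → 2 * (1 + x + 1) ≡ 4 + 2 * x
  double = solve-∀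
  rearrange : ∀ x y z → x + (4 + (y + z)) ≡ x + y + 4 + z
  rearrange = solve-∀

mainTheorem8 : ∀ {n} (H : Hypergraph n) → Intersecting H → ∀ (t Δ : ℕ) →
    IsCoveringNumber H t → IsMaxDegree H Δ →
    (t ≤ 1 + ⌈ (numEdges H ∸ Δ) /2⌉)
    × (∀ (r : ℕ) → Uniform r H → t + 1 ≡ r →
        ((numEdges H ∸ Δ) % 2 ≡ 0 → Δ + 2 * r ≤ numEdges H + 4)
        × ((numEdges H ∸ Δ) % 2 ≡ 1 → Δ + 2 * r ≤ numEdges H + 5))
mainTheorem8 H intersecting t Δ τ ((v , degree≡Δ) , _) = τ≤ , degree-bounds
  where
  e = numEdges H

  τ≤ : t ≤ 1 + ⌈ (e ∸ Δ) /2⌉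
  τ≤ = subst (λ d → t ≤ 1 + ⌈ (e ∸ d) /2⌉) degree≡Δ (τ≤1+⌈[e∸degree]/2⌉ H intersecting τ v)

  Δ≤e : Δ ≤ e
  Δ≤e = subst (_≤ e) degree≡Δ (degree≤numEdges H v)

  degree-bounds : ∀ r → Uniform r H → t + 1 ≡ r →
                  ((e ∸ Δ) % 2 ≡ 0 → Δ + 2 * r ≤ e + 4) × ((e ∸ Δ) % 2 ≡ 1 → Δ + 2 * r ≤ e + 5)
  degree-bounds r _ refl = even , odd
    where
    bound : Δ + 2 * (t + 1) ≤ e + 4 + (e ∸ Δ) % 2
    bound = Δ+2[τ+1]≤e+4+[e∸Δ]%2 Δ≤e τ≤
    even : (e ∸ Δ) % 2 ≡ 0 → Δ + 2 * r ≤ e + 4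
    even p≡0 = ≤-trans bound (≤-reflexive (trans (cong (e + 4 +_) p≡0) (+-identityʳ (e + 4))))
    odd : (e ∸ Δ) % 2 ≡ 1 → Δ + 2 * r ≤ e + 5
    odd p≡1 = ≤-trans bound (≤-reflexive (trans (cong (e + 4 +_) p≡1) (+-assoc e 4 1)))
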